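{- Let $n \geq 1$ be an integer with prime factorisation $n=\prod_{i=1}^m \varphi_i^{a_i}$ ($\varphi_1,\dots,\varphi_m$ distinct primes, $a_i\ge 1$), and let $x>1$ be an integer. Let $\omega_n$ be the number of distinct prime factors of $x^n-1$. Then $$x \;\geq\; \min\left[\,\max\left\{\left(1+\prod_{j=0}^{t}\prod_{i=1}^{k_j} r_{i,j}\right)^{T(t)} \;\middle|\; t\in\{0,1,\dots,m\}\right\} \;\middle|\; (k_0,\dots,k_m)\in\mathbb{Z}_{\ge 0}^{m+1},\ \sum_{s=0}^m k_s=\omega_n\right],$$ where in the minimum only tuples with $k_j\le|\Pi_n^j|$ for all $j$ are admitted (so that every $r_{i,j}$ occurring is defined).
   Context: Set $\varphi_0:=1$. For $j\in\{0,1,\dots,m\}$ let $\Pi_n^j$ be the set of primes $\rho$ with $\rho\equiv 1 \pmod{\varphi_j}$ and $\rho\not\equiv 1\pmod{\varphi_i}$ for every $i$ with $j<i\le m$ (for $j=0$ the first condition is vacuous). These sets partition the set of all primes. Let $r_{i,j}$ denote the $i$-th smallest element of $\Pi_n^j$. Let $T(t)=\prod_{k=1}^{t}\varphi_k^{ -a_k}$ (so $T(0)=1$ and $T(m)=1/n$). Empty products equal $1$. -}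

module Defs where

open import Data.Nat using (ℕ; zero; suc; _+_; _*_; _∸_; _^_; _≤_; _<_; _<ᵇ_; _≤ᵇ_)
open import Data.Nat.Divisibility using (_∣_; _∣?_)
open import Data.Nat.Primality using (Prime; prime?)
open import Data.Fin using (Fin; zero; suc; toℕ)
open import Data.List using (List; length; filter; upTo)
open import Data.Nat.ListAction using (product)
open import Data.List.Relation.Unary.All using (All)
open import Data.List.Relation.Unary.Linked using (Linked)
open import Data.List.Membership.Propositional using (_∉_)
open import Data.Bool using (if_then_else_)
open import Data.Product using (_×_)
open import Relation.Nullary.Negation using (¬_)
open import Relation.Nullary.Decidable using (_×-dec_)
open import Function using (_∘_)
open import Relation.Binary.PropositionalEquality using (_≡_)

prodFin : ∀ {m} → (Fin m → ℕ) → ℕ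
prodFin {zero} f = 1
prodFin {suc m} f = f zero * prodFin (f ∘ suc)

sumFin : ∀ {m} → (Fin m → ℕ) → ℕ
sumFin {zero} f = 0
sumFin {suc m} f = f zero + sumFin (f ∘ suc)

-- ω N : number of distinct prime divisors of N (for N ≥ 1 they are all ≤ N)
ω : ℕ → ℕ
ω N = length (filter (λ p → prime? p ×-dec (p ∣? N)) (upTo (suc N)))

-- The primes φ₁..φₘ are given as φ : Fin m → ℕ, where index i : Fin m
-- stands for φ_{toℕ i + 1}.  Class indices j ∈ {0..m} are Fin (suc m).
-- φ̂ j = φ_j with φ_0 = 1.
φ̂ : ∀ {m} → (Fin m → ℕ) → Fin (suc m) → ℕ
φ̂ φ zero = 1
φ̂ φ (suc i) = φ i

-- "ρ ≡ 1 (mod q)" for ρ ≥ 1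
≡1mod : ℕ → ℕ → Set
≡1mod q ρ = q ∣ ρ ∸ 1

Cls : ∀ {m} → (Fin m → ℕ) → Fin (suc m) → ℕ → Set
Cls {m} φ j ρ = Prime ρ × ≡1mod (φ̂ φ j) ρ
          × (∀ (i : Fin m) → toℕ j < suc (toℕ i) → ¬ ≡1mod (φ i) ρ)

-- l lists exactly the k smallest elements of S, in increasing order
-- (so l = (r_1, …, r_k); such l exists iff k ≤ |S|)
record FirstElems (S : ℕ → Set) (k : ℕ) (l : List ℕ) : Set where
  field
    len     : length l ≡ k
    sorted  : Linked _<_ l
    members : All S l
    initial : ∀ p → S p → p ∉ l → All (_< p) l

-- 1 / T(t) = ∏_{k=1}^{t} φ_k^{a_k}
invT : ∀ {m} → (Fin m → ℕ) → (Fin m → ℕ) → Fin (suc m) → ℕ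
invT φ a t = prodFin (λ i → if toℕ i <ᵇ toℕ t then φ i ^ a i else 1)

prodClasses : ∀ {m} → (Fin (suc m) → List ℕ) → Fin (suc m) → ℕ
prodClasses L t = prodFin (λ j → if toℕ j ≤ᵇ toℕ t then product (L j) else 1)

{-# OPTIONS --safe #-}
-- Let p be a prime divisor of x ^ n − 1 lying in the class Π_n^j. As p ∤ x, Fermat gives
-- p ∣ x ^ (p − 1) − 1, hence p ∣ x ^ gcd(n, p − 1) − 1. By definition of Π_n^j, p − 1 is prime to
-- every φₖ with k > j, so gcd(n, p − 1) divides 1/T(t) = ∏_{k ≤ t} φₖ ^ aₖ whenever t ≥ j. Hence the
-- product of the prime divisors of x ^ n − 1 lying in Π_n^0, …, Π_n^t divides x ^ (1/T(t)) − 1.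
-- Take k_j to be the number of prime divisors of x ^ n − 1 in Π_n^j, so that Σ k_j = ω_n. The k_j
-- smallest elements of Π_n^j have product at most that of those k_j prime divisors, and therefore
-- 1 + ∏_{j ≤ t} ∏_{i ≤ k_j} r_{i,j} ≤ x ^ (1/T(t)) for every t.
module Submission where

open import Defs
open import Data.Nat using (ℕ; zero; suc; _+_; _*_; _∸_; _^_; _≤_; _<_; _≤ᵇ_; _<ᵇ_;
  z≤n; s≤s; z<s; NonZero; >-nonZero; >-nonZero⁻¹; _≤‴_; ≤‴-refl; ≤‴-step; +-*-rawSemiring)
open import Data.Nat.Properties hiding (_≟_; suc-injective)
open import Data.Nat.Divisibility
open import Data.Nat.Primality using (Prime; prime?; ¬prime[1]; prime⇒irreducible; prime⇒nonZero; euclidsLemma)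
open import Data.Nat.GCD using (gcd; gcd[m,n]∣m; gcd[m,n]∣n; gcd-GCD; module Bézout)
open import Data.Nat.LCM using (lcm; lcm-least; gcd*lcm)
open import Data.Nat.Coprimality using (Coprime; coprime-divisor; coprime⇒gcd≡1; prime⇒coprime)
import Data.Nat.Coprimality as Coprime
open import Data.Nat.Combinatorics using (_C_; nCn≡1; nC1≡n; nCk+nC[k+1]≡[n+1]C[k+1])
open import Data.Nat.ListAction using (product)
open import Data.Nat.ListAction.Properties using (product-++)
open import Data.Nat.Tactic.RingSolver using (solve-∀)
open import Data.Fin using (Fin; zero; suc; toℕ; fromℕ; inject₁)
open import Data.Fin.Properties using (_≟_; all?; suc-injective; toℕ-fromℕ; toℕ-inject₁; toℕ<n)
open import Data.Bool using (Bool; true; false; if_then_else_; T)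
open import Data.List using (List; []; _∷_; [_]; _++_; length; filter; upTo)
open import Data.List.Properties using (length-++; filter-++; filter-accept; filter-reject)
open import Data.List.Relation.Unary.All using (All; []; _∷_)
import Data.List.Relation.Unary.All as All
open import Data.List.Relation.Unary.AllPairs using (AllPairs; []; _∷_)
import Data.List.Relation.Unary.AllPairs.Properties as AllPairs
open import Data.List.Relation.Unary.Linked using (Linked; []; [-]; _∷_)
open import Data.List.Relation.Unary.Any using (here; there)
open import Data.List.Membership.Propositional using (_∈_; _∉_)
open import Data.List.Membership.Propositional.Properties using (∈-filter⁻)
open import Data.Vec.Functional using (Vector; init; tail)
open import Data.Product using (Σ; ∃-syntax; _×_; _,_; proj₁; proj₂)
open import Data.Sum using (inj₁; inj₂)
open import Function using (_∘_; id)
open import Relation.Binary.PropositionalEquality using (_≡_; _≢_; refl; sym; trans; cong; cong₂; subst; module ≡-Reasoning)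
open import Relation.Nullary using (¬_; yes; no; contradiction)
open import Relation.Nullary.Decidable using (_×-dec_; _→-dec_; ¬?; T?)
open import Relation.Unary using (Decidable)
import Algebra.Properties.CommutativeSemiring.Binomial as Binomial
open import Algebra.Properties.Monoid.Sum +-0-monoid using (sum; sum-init-last)
open import Algebra.Definitions.RawSemiring +-*-rawSemiring using ()
  renaming (_×_ to _×ₛ_; _^_ to _^ₛ_)
open Binomial +-*-commutativeSemiring using (binomialTerm) renaming (theorem to binomial-theorem)
open import Algebra.Properties.CommutativeSemigroup *-commutativeSemigroup using ()
  renaming (interchange to *-interchange)
open import Algebra.Properties.CommutativeSemigroup +-commutativeSemigroup using ()
  renaming (interchange to +-interchange)

prodFin-cong : ∀ {M} {f g : Fin M → ℕ} → (∀ i → f i ≡ g i) → prodFin f ≡ prodFin g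
prodFin-cong {zero} f≗g = refl
prodFin-cong {suc M} f≗g = cong₂ _*_ (f≗g zero) (prodFin-cong (f≗g ∘ suc))

sumFin-cong : ∀ {M} {f g : Fin M → ℕ} → (∀ i → f i ≡ g i) → sumFin f ≡ sumFin g
sumFin-cong {zero} f≗g = refl
sumFin-cong {suc M} f≗g = cong₂ _+_ (f≗g zero) (sumFin-cong (f≗g ∘ suc))

prodFin-distrib-* : ∀ {M} (f g : Fin M → ℕ) → prodFin (λ i → f i * g i) ≡ prodFin f * prodFin g
prodFin-distrib-* {zero} f g = refl
prodFin-distrib-* {suc M} f g = trans (cong (f zero * g zero *_) (prodFin-distrib-* (f ∘ suc) (g ∘ suc)))
  (*-interchange (f zero) (g zero) (prodFin (f ∘ suc)) (prodFin (g ∘ suc)))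

sumFin-distrib-+ : ∀ {M} (f g : Fin M → ℕ) → sumFin (λ i → f i + g i) ≡ sumFin f + sumFin g
sumFin-distrib-+ {zero} f g = refl
sumFin-distrib-+ {suc M} f g = trans (cong (f zero + g zero +_) (sumFin-distrib-+ (f ∘ suc) (g ∘ suc)))
  (+-interchange (f zero) (g zero) (sumFin (f ∘ suc)) (sumFin (g ∘ suc)))

prodFin-1 : ∀ {M} (f : Fin M → ℕ) → (∀ i → f i ≡ 1) → prodFin f ≡ 1
prodFin-1 {zero} f f≗1 = refl
prodFin-1 {suc M} f f≗1 = cong₂ _*_ (f≗1 zero) (prodFin-1 (f ∘ suc) (f≗1 ∘ suc))

sumFin-0 : ∀ {M} (f : Fin M → ℕ) → (∀ i → f i ≡ 0) → sumFin f ≡ 0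
sumFin-0 {zero} f f≗0 = refl
sumFin-0 {suc M} f f≗0 = cong₂ _+_ (f≗0 zero) (sumFin-0 (f ∘ suc) (f≗0 ∘ suc))

prodFin-δ : ∀ {M} (f : Fin M → ℕ) i → (∀ j → j ≢ i → f j ≡ 1) → prodFin f ≡ f i
prodFin-δ {suc M} f zero f≗1 =
  trans (cong (f zero *_) (prodFin-1 (f ∘ suc) (λ j → f≗1 (suc j) λ ()))) (*-identityʳ (f zero))
prodFin-δ {suc M} f (suc i) f≗1 =
  trans (cong₂ _*_ (f≗1 zero λ ()) (prodFin-δ (f ∘ suc) i (λ j j≢i → f≗1 (suc j) (j≢i ∘ suc-injective))))
        (*-identityˡ (f (suc i)))

sumFin-δ : ∀ {M} (f : Fin M → ℕ) i → (∀ j → j ≢ i → f j ≡ 0) → sumFin f ≡ f i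
sumFin-δ {suc M} f zero f≗0 =
  trans (cong (f zero +_) (sumFin-0 (f ∘ suc) (λ j → f≗0 (suc j) λ ()))) (+-identityʳ (f zero))
sumFin-δ {suc M} f (suc i) f≗0 =
  cong₂ _+_ (f≗0 zero λ ()) (sumFin-δ (f ∘ suc) i (λ j j≢i → f≗0 (suc j) (j≢i ∘ suc-injective)))

prodFin-mono-≤ : ∀ {M} {f g : Fin M → ℕ} → (∀ i → f i ≤ g i) → prodFin f ≤ prodFin g
prodFin-mono-≤ {zero} f≤g = ≤-refl
prodFin-mono-≤ {suc M} f≤g = *-mono-≤ (f≤g zero) (prodFin-mono-≤ (f≤g ∘ suc))

prodFin-positive : ∀ {M} {f : Fin M → ℕ} → (∀ i → 1 ≤ f i) → 1 ≤ prodFin f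
prodFin-positive {M} 1≤f = ≤-trans (≤-reflexive (sym (prodFin-1 {M} (λ _ → 1) λ _ → refl))) (prodFin-mono-≤ 1≤f)

module _ {A : Set} {M} (c : A → Fin M) where

  fibre : Fin M → List A → List A
  fibre j = filter (λ x → c x ≟ j)

  fibre-∷ : ∀ j x xs → fibre j (x ∷ xs) ≡ fibre j [ x ] ++ fibre j xs
  fibre-∷ j x xs = filter-++ (λ x → c x ≟ j) [ x ] xs

  fibre-own : ∀ x → fibre (c x) [ x ] ≡ [ x ]
  fibre-own x = filter-accept (λ y → c y ≟ c x) refl

  fibre-other : ∀ {j} x → j ≢ c x → fibre j [ x ] ≡ []
  fibre-other x j≢cx = filter-reject (λ x → c x ≟ _) (j≢cx ∘ sym)

  sumFin-length-fibre : ∀ xs → sumFin (λ j → length (fibre j xs)) ≡ length xs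
  sumFin-length-fibre [] = sumFin-0 {M} (λ _ → 0) λ _ → refl
  sumFin-length-fibre (x ∷ xs) = begin
    sumFin (λ j → length (fibre j (x ∷ xs)))
      ≡⟨ sumFin-cong split ⟩
    sumFin (λ j → length (fibre j [ x ]) + length (fibre j xs))
      ≡⟨ sumFin-distrib-+ {M} _ _ ⟩
    sumFin (λ j → length (fibre j [ x ])) + sumFin (λ j → length (fibre j xs))
      ≡⟨ cong₂ _+_ at-own-class (sumFin-length-fibre xs) ⟩
    1 + length xs ∎
    where
    open ≡-Reasoning
    split : ∀ j → length (fibre j (x ∷ xs)) ≡ length (fibre j [ x ]) + length (fibre j xs)
    split j rewrite fibre-∷ j x xs = length-++ (fibre j [ x ])
    at-own-class : sumFin (λ j → length (fibre j [ x ])) ≡ 1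
    at-own-class rewrite sumFin-δ _ (c x) (λ j j≢cx → cong length (fibre-other x j≢cx)) | fibre-own x = refl

if-1 : ∀ b → (if b then 1 else 1) ≡ 1
if-1 true = refl
if-1 false = refl

if-* : ∀ b {u v} → (if b then u * v else 1) ≡ (if b then u else 1) * (if b then v else 1)
if-* true = refl
if-* false = refl

module _ {M} (c : ℕ → Fin M) (g : Fin M → Bool) where

  product-filter-∷ : ∀ x xs → product (filter (T? ∘ g ∘ c) (x ∷ xs))
                             ≡ (if g (c x) then product [ x ] else 1) * product (filter (T? ∘ g ∘ c) xs)
  product-filter-∷ x xs with g (c x)
  ... | true = cong (_* product (filter (T? ∘ g ∘ c) xs)) (sym (*-identityʳ x))
  ... | false = sym (*-identityˡ _)

  prodFin-product-fibre : ∀ xs → prodFin (λ j → if g j then product (fibre c j xs) else 1)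
                                ≡ product (filter (T? ∘ g ∘ c) xs)
  prodFin-product-fibre [] = prodFin-1 _ λ j → if-1 (g j)
  prodFin-product-fibre (x ∷ xs) = begin
    prodFin (λ j → selected j (x ∷ xs))                          ≡⟨ prodFin-cong split ⟩
    prodFin (λ j → selected j [ x ] * selected j xs)             ≡⟨ prodFin-distrib-* {M} _ _ ⟩
    prodFin (λ j → selected j [ x ]) * prodFin (λ j → selected j xs)
      ≡⟨ cong₂ _*_ at-own-class (prodFin-product-fibre xs) ⟩
    (if g (c x) then product [ x ] else 1) * product (filter (T? ∘ g ∘ c) xs)
      ≡⟨ sym (product-filter-∷ x xs) ⟩
    product (filter (T? ∘ g ∘ c) (x ∷ xs))                       ∎
    where
    open ≡-Reasoning
    selected : Fin M → List ℕ → ℕ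
    selected j ys = if g j then product (fibre c j ys) else 1
    split : ∀ j → selected j (x ∷ xs) ≡ selected j [ x ] * selected j xs
    split j rewrite fibre-∷ c j x xs | product-++ (fibre c j [ x ]) (fibre c j xs) = if-* (g j)
    elsewhere : ∀ j → j ≢ c x → selected j [ x ] ≡ 1
    elsewhere j j≢cx rewrite fibre-other c x j≢cx = if-1 (g j)
    at-own-class : prodFin (λ j → selected j [ x ]) ≡ (if g (c x) then product [ x ] else 1)
    at-own-class rewrite prodFin-δ _ (c x) elsewhere | fibre-own c x = refl

coprime-1 : ∀ d → Coprime d 1
coprime-1 d (_ , i∣1) = ∣1⇒≡1 i∣1

coprime-* : ∀ {d m n} → Coprime d m → Coprime d n → Coprime d (m * n)
coprime-* {d} {m} cop-m cop-n {i} (i∣d , i∣mn) = cop-n (i∣d , coprime-divisor cop[i,m] i∣mn)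
  where
  cop[i,m] : Coprime i m
  cop[i,m] (j∣i , j∣m) = cop-m (∣-trans j∣i i∣d , j∣m)

coprime-^ : ∀ {d m} → Coprime d m → ∀ k → Coprime d (m ^ k)
coprime-^ {d} cop zero = coprime-1 d
coprime-^ cop (suc k) = coprime-* cop (coprime-^ cop k)

coprime-prodFin : ∀ {d M} (f : Fin M → ℕ) → (∀ i → Coprime d (f i)) → Coprime d (prodFin f)
coprime-prodFin {d} {zero} f cop = coprime-1 d
coprime-prodFin {d} {suc M} f cop = coprime-* (cop zero) (coprime-prodFin (f ∘ suc) (cop ∘ suc))

coprime-product : ∀ {d ns} → All (Coprime d) ns → Coprime d (product ns)
coprime-product {d} [] = coprime-1 d
coprime-product (cop ∷ cops) = coprime-* cop (coprime-product cops)

∤⇒coprime : ∀ {m p} → Prime p → ¬ p ∣ m → Coprime m p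
∤⇒coprime p-prime p∤m (i∣m , i∣p) with prime⇒irreducible p-prime i∣p
... | inj₁ i≡1 = i≡1
... | inj₂ refl = contradiction i∣m p∤m

coprime⇒*∣ : ∀ {m n c} → Coprime m n → m ∣ c → n ∣ c → m * n ∣ c
coprime⇒*∣ {m} {n} cop m∣c n∣c = subst (_∣ _) lcm≡m*n (lcm-least m∣c n∣c)
  where
  lcm≡m*n : lcm m n ≡ m * n
  lcm≡m*n = trans (sym (*-identityˡ (lcm m n)))
                  (trans (cong (_* lcm m n) (sym (coprime⇒gcd≡1 cop))) (gcd*lcm m n))

product-∣ : ∀ {ns c} → AllPairs Coprime ns → All (_∣ c) ns → product ns ∣ c
product-∣ {c = c} [] [] = 1∣ c
product-∣ (cops ∷ pairwise) (n∣c ∷ ns∣c) = coprime⇒*∣ (coprime-product cops) n∣c (product-∣ pairwise ns∣c)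

coprime-primes : ∀ {p q} → Prime p → Prime q → p < q → Coprime p q
coprime-primes p-prime q-prime p<q = Coprime.sym (prime⇒coprime q-prime {{prime⇒nonZero p-prime}} p<q)

sorted-primes-coprime : ∀ {ps} → All Prime ps → AllPairs _<_ ps → AllPairs Coprime ps
sorted-primes-coprime [] [] = []
sorted-primes-coprime (p-prime ∷ ps-prime) (p<ps ∷ sorted) =
  All.zipWith (λ (p<q , q-prime) {i} → coprime-primes p-prime q-prime p<q {i}) (p<ps , ps-prime)
  ∷ sorted-primes-coprime ps-prime sorted

-- Divisors of x ^ e ∸ 1

module _ (x : ℕ) .{{_ : NonZero x}} where

  x^[m+n]∸1≡x^m*[x^n∸1]+[x^m∸1] : ∀ m n → x ^ (m + n) ∸ 1 ≡ x ^ m * (x ^ n ∸ 1) + (x ^ m ∸ 1)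
  x^[m+n]∸1≡x^m*[x^n∸1]+[x^m∸1] m n = begin
    x ^ (m + n) ∸ 1                             ≡⟨ cong (_∸ 1) (^-distribˡ-+-* x m n) ⟩
    x ^ m * x ^ n ∸ 1                           ≡⟨ cong (_∸ 1) (m∸n+n≡m (m≤m*n (x ^ m) (x ^ n) {{m^n≢0 x n}})) ⟨
    (x ^ m * x ^ n ∸ x ^ m) + x ^ m ∸ 1         ≡⟨ +-∸-assoc (x ^ m * x ^ n ∸ x ^ m) (m^n>0 x m) ⟩
    (x ^ m * x ^ n ∸ x ^ m) + (x ^ m ∸ 1)       ≡⟨ cong (λ u → (x ^ m * x ^ n ∸ u) + (x ^ m ∸ 1)) (*-identityʳ (x ^ m)) ⟨
    (x ^ m * x ^ n ∸ x ^ m * 1) + (x ^ m ∸ 1)   ≡⟨ cong (_+ (x ^ m ∸ 1)) (*-distribˡ-∸ (x ^ m) (x ^ n) 1) ⟨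
    x ^ m * (x ^ n ∸ 1) + (x ^ m ∸ 1)           ∎
    where open ≡-Reasoning

  x∣x^k : ∀ {k} → 1 ≤ k → x ∣ x ^ k
  x∣x^k {suc k} _ = m∣m*n (x ^ k)

  module _ {d : ℕ} where

    ∣x^m∸1⇒coprime : ∀ m → d ∣ x ^ m ∸ 1 → Coprime d (x ^ m)
    ∣x^m∸1⇒coprime m d∣x^m∸1 {i} (i∣d , i∣x^m) = ∣1⇒≡1 (∣m+n∣m⇒∣n i∣x^m∸1+1 (∣-trans i∣d d∣x^m∸1))
      where
      i∣x^m∸1+1 : i ∣ (x ^ m ∸ 1) + 1
      i∣x^m∸1+1 = subst (_ ∣_) (sym (m∸n+n≡m (m^n>0 x m))) i∣x^m

    ∣x^m∸1∧∣x^n∸1⇒∣x^[m+n]∸1 : ∀ m n → d ∣ x ^ m ∸ 1 → d ∣ x ^ n ∸ 1 → d ∣ x ^ (m + n) ∸ 1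
    ∣x^m∸1∧∣x^n∸1⇒∣x^[m+n]∸1 m n d∣x^m∸1 d∣x^n∸1 =
      subst (d ∣_) (sym (x^[m+n]∸1≡x^m*[x^n∸1]+[x^m∸1] m n)) (∣m∣n⇒∣m+n (∣n⇒∣m*n (x ^ m) d∣x^n∸1) d∣x^m∸1)

    ∣x^[m+n]∸1∧∣x^m∸1⇒∣x^n∸1 : ∀ m n → d ∣ x ^ (m + n) ∸ 1 → d ∣ x ^ m ∸ 1 → d ∣ x ^ n ∸ 1
    ∣x^[m+n]∸1∧∣x^m∸1⇒∣x^n∸1 m n d∣x^[m+n]∸1 d∣x^m∸1 =
      coprime-divisor (∣x^m∸1⇒coprime m d∣x^m∸1) d∣x^m*[x^n∸1]
      where
      d∣x^m*[x^n∸1] : d ∣ x ^ m * (x ^ n ∸ 1)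
      d∣x^m*[x^n∸1] = ∣m+n∣m⇒∣n
        (subst (d ∣_) (trans (x^[m+n]∸1≡x^m*[x^n∸1]+[x^m∸1] m n) (+-comm (x ^ m * (x ^ n ∸ 1)) _)) d∣x^[m+n]∸1)
        d∣x^m∸1

    ∣x^m∸1⇒∣x^[k*m]∸1 : ∀ k m → d ∣ x ^ m ∸ 1 → d ∣ x ^ (k * m) ∸ 1
    ∣x^m∸1⇒∣x^[k*m]∸1 zero m _ = _ ∣0
    ∣x^m∸1⇒∣x^[k*m]∸1 (suc k) m d∣x^m∸1 =
      ∣x^m∸1∧∣x^n∸1⇒∣x^[m+n]∸1 m (k * m) d∣x^m∸1 (∣x^m∸1⇒∣x^[k*m]∸1 k m d∣x^m∸1)

    ∣x^m∸1∧m∣n⇒∣x^n∸1 : ∀ {m n} → m ∣ n → d ∣ x ^ m ∸ 1 → d ∣ x ^ n ∸ 1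
    ∣x^m∸1∧m∣n⇒∣x^n∸1 {m} (divides k refl) = ∣x^m∸1⇒∣x^[k*m]∸1 k m

    Bézout⇒∣x^g∸1 : ∀ {g m n} u v → g + v * n ≡ u * m → d ∣ x ^ m ∸ 1 → d ∣ x ^ n ∸ 1 → d ∣ x ^ g ∸ 1
    Bézout⇒∣x^g∸1 {g} {m} {n} u v g+vn≡um d∣x^m∸1 d∣x^n∸1 = ∣x^[m+n]∸1∧∣x^m∸1⇒∣x^n∸1 (v * n) g
      (subst (λ e → d ∣ x ^ e ∸ 1) (trans (sym g+vn≡um) (+-comm g (v * n))) (∣x^m∸1⇒∣x^[k*m]∸1 u m d∣x^m∸1))
      (∣x^m∸1⇒∣x^[k*m]∸1 v n d∣x^n∸1)

    ∣x^m∸1∧∣x^n∸1⇒∣x^gcd[m,n]∸1 : ∀ m n → d ∣ x ^ m ∸ 1 → d ∣ x ^ n ∸ 1 → d ∣ x ^ gcd m n ∸ 1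
    ∣x^m∸1∧∣x^n∸1⇒∣x^gcd[m,n]∸1 m n d∣x^m∸1 d∣x^n∸1 with Bézout.identity (gcd-GCD m n)
    ... | Bézout.+- u v eq = Bézout⇒∣x^g∸1 u v eq d∣x^m∸1 d∣x^n∸1
    ... | Bézout.-+ u v eq = Bézout⇒∣x^g∸1 v u eq d∣x^n∸1 d∣x^m∸1

-- Fermat's little theorem

[1+k]*[1+n]C[1+k]≡[1+n]*nCk : ∀ n k → suc k * (suc n C suc k) ≡ suc n * (n C k)
[1+k]*[1+n]C[1+k]≡[1+n]*nCk zero zero = refl
[1+k]*[1+n]C[1+k]≡[1+n]*nCk zero (suc k) = *-zeroʳ (suc (suc k))
[1+k]*[1+n]C[1+k]≡[1+n]*nCk (suc n) zero =
  trans (+-identityʳ (suc (suc n) C 1)) (trans (nC1≡n (suc (suc n))) (sym (*-identityʳ (suc (suc n)))))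
[1+k]*[1+n]C[1+k]≡[1+n]*nCk (suc n) (suc k) = begin
  suc (suc k) * (suc (suc n) C suc (suc k))        ≡⟨ cong (suc (suc k) *_) (sym (nCk+nC[k+1]≡[n+1]C[k+1] (suc n) (suc k))) ⟩
  suc (suc k) * (A + B)                            ≡⟨ regroup k A B ⟩
  A + (suc k * A + suc (suc k) * B)                ≡⟨ cong₂ (λ u v → A + (u + v)) ([1+k]*[1+n]C[1+k]≡[1+n]*nCk n k)
                                                                                ([1+k]*[1+n]C[1+k]≡[1+n]*nCk n (suc k)) ⟩
  A + (suc n * (n C k) + suc n * (n C suc k))      ≡⟨ cong (A +_) (sym (*-distribˡ-+ (suc n) (n C k) (n C suc k))) ⟩
  A + suc n * (n C k + n C suc k)                  ≡⟨ cong (λ u → A + suc n * u) (nCk+nC[k+1]≡[n+1]C[k+1] n k) ⟩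
  suc (suc n) * A                                  ∎
  where
  open ≡-Reasoning
  A B : ℕ
  A = suc n C suc k
  B = suc n C suc (suc k)
  regroup : ∀ k A B → suc (suc k) * (A + B) ≡ A + (suc k * A + suc (suc k) * B)
  regroup = solve-∀

p∣pCk : ∀ {p k} → Prime p → 0 < k → k < p → p ∣ p C k
p∣pCk {suc n} {suc k} p-prime _ k<p
  with euclidsLemma (suc k) (suc n C suc k) p-prime
         (divides (n C k) (trans ([1+k]*[1+n]C[1+k]≡[1+n]*nCk n k) (*-comm (suc n) (n C k))))
... | inj₁ p∣k = contradiction (∣⇒≤ p∣k) (<⇒≱ k<p)
... | inj₂ p∣C = p∣C

×ₛ≡* : ∀ k b → k ×ₛ b ≡ k * b
×ₛ≡* zero b = refl
×ₛ≡* (suc k) b = cong (b +_) (×ₛ≡* k b)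

^ₛ≡^ : ∀ b k → b ^ₛ k ≡ b ^ k
^ₛ≡^ b zero = refl
^ₛ≡^ b (suc k) = cong (b *_) (^ₛ≡^ b k)

binomialTerm[a,1]≡ : ∀ a n k → binomialTerm a 1 n k ≡ (n C toℕ k) * a ^ toℕ k
binomialTerm[a,1]≡ a n k = begin
  binomialTerm a 1 n k
    ≡⟨ ×ₛ≡* (n C toℕ k) _ ⟩
  (n C toℕ k) * (a ^ₛ toℕ k * 1 ^ₛ (n ∸ toℕ k))
    ≡⟨ cong (λ u → (n C toℕ k) * (a ^ₛ toℕ k * u)) (trans (^ₛ≡^ 1 (n ∸ toℕ k)) (^-zeroˡ (n ∸ toℕ k))) ⟩
  (n C toℕ k) * (a ^ₛ toℕ k * 1)
    ≡⟨ cong ((n C toℕ k) *_) (trans (*-identityʳ _) (^ₛ≡^ a (toℕ k))) ⟩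
  (n C toℕ k) * a ^ toℕ k ∎
  where open ≡-Reasoning

∣-sum : ∀ {d n} (f : Vector ℕ n) → (∀ i → d ∣ f i) → d ∣ sum f
∣-sum {n = zero} f _ = _ ∣0
∣-sum {n = suc n} f d∣f = ∣m∣n⇒∣m+n (d∣f zero) (∣-sum (f ∘ suc) (d∣f ∘ suc))

-- Only the two outer terms of the binomial expansion of (a + 1) ^ p survive modulo p.
[a+1]^p≡1+a^p+p*q : ∀ {p} → Prime p → ∀ a → ∃[ q ] (a + 1) ^ p ≡ 1 + a ^ p + p * q
[a+1]^p≡1+a^p+p*q {p@(suc p′)} p-prime a = q , (begin
  (a + 1) ^ p
    ≡⟨ ^ₛ≡^ (a + 1) p ⟨
  (a + 1) ^ₛ p
    ≡⟨ binomial-theorem p a 1 ⟩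
  term zero + sum (tail term)
    ≡⟨ cong (term zero +_) (sum-init-last (tail term)) ⟩
  term zero + (sum (init (tail term)) + term (fromℕ p))
    ≡⟨ cong₂ (λ u v → u + (v + term (fromℕ p))) (binomialTerm[a,1]≡ a p zero) (equality p∣inner) ⟩
  1 + (q * p + term (fromℕ p))
    ≡⟨ cong (λ u → 1 + (q * p + u)) top ⟩
  1 + (q * p + a ^ p)
    ≡⟨ cong suc (trans (+-comm (q * p) (a ^ p)) (cong (a ^ p +_) (*-comm q p))) ⟩
  1 + a ^ p + p * q ∎)
  where
  open ≡-Reasoning
  open _∣_
  term : Vector ℕ (suc p)
  term = binomialTerm a 1 p
  p∣inner : p ∣ sum (init (tail term))
  p∣inner = ∣-sum (init (tail term)) λ i → subst (p ∣_) (sym (binomialTerm[a,1]≡ a p (suc (inject₁ i))))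
    (∣m⇒∣m*n _ (p∣pCk p-prime z<s (s≤s (subst (_< p′) (sym (toℕ-inject₁ i)) (toℕ<n i)))))
  q : ℕ
  q = quotient p∣inner
  top : term (fromℕ p) ≡ a ^ p
  top = begin
    term (fromℕ p)                          ≡⟨ binomialTerm[a,1]≡ a p (fromℕ p) ⟩
    (p C toℕ (fromℕ p)) * a ^ toℕ (fromℕ p) ≡⟨ cong (λ k → (p C k) * a ^ k) (toℕ-fromℕ p) ⟩
    (p C p) * a ^ p                         ≡⟨ cong (_* a ^ p) (nCn≡1 p) ⟩
    1 * a ^ p                               ≡⟨ *-identityˡ (a ^ p) ⟩
    a ^ p                                   ∎

a^p≡a+p*q : ∀ {p} → Prime p → ∀ a → ∃[ q ] a ^ p ≡ a + p * q
a^p≡a+p*q {p@(suc _)} p-prime zero = 0 , sym (*-zeroʳ p)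
a^p≡a+p*q {p} p-prime (suc a) with a^p≡a+p*q p-prime a | [a+1]^p≡1+a^p+p*q p-prime a
... | q , a^p≡ | q′ , [a+1]^p≡ = q + q′ , (begin
  suc a ^ p                    ≡⟨ cong (_^ p) (+-comm 1 a) ⟩
  (a + 1) ^ p                  ≡⟨ [a+1]^p≡ ⟩
  1 + a ^ p + p * q′           ≡⟨ cong (λ u → 1 + u + p * q′) a^p≡ ⟩
  1 + (a + p * q) + p * q′     ≡⟨ regroup a p q q′ ⟩
  suc a + p * (q + q′)         ∎)
  where
  open ≡-Reasoning
  regroup : ∀ a p q q′ → 1 + (a + p * q) + p * q′ ≡ suc a + p * (q + q′)
  regroup = solve-∀

fermat : ∀ {p a} → Prime p → ¬ p ∣ a → p ∣ a ^ (p ∸ 1) ∸ 1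
fermat {p@(suc p′)} {a} p-prime p∤a with a^p≡a+p*q p-prime a
... | q , a^p≡ with euclidsLemma a (a ^ p′ ∸ 1) p-prime (divides q a*[a^p′∸1]≡q*p)
  where
  a*[a^p′∸1]≡q*p : a * (a ^ p′ ∸ 1) ≡ q * p
  a*[a^p′∸1]≡q*p = begin
    a * (a ^ p′ ∸ 1)   ≡⟨ *-distribˡ-∸ a (a ^ p′) 1 ⟩
    a ^ p ∸ a * 1      ≡⟨ cong₂ _∸_ a^p≡ (*-identityʳ a) ⟩
    a + p * q ∸ a      ≡⟨ m+n∸m≡n a (p * q) ⟩
    p * q              ≡⟨ *-comm p q ⟩
    q * p              ∎
    where open ≡-Reasoning
... | inj₁ p∣a = contradiction p∣a p∤a
... | inj₂ p∣a^p′∸1 = p∣a^p′∸1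

-- The classes Π_n^j

-- The largest j with φ̂ φ j ∣ ρ ∸ 1, so that a prime ρ lies in Π_n^j.
cls : ∀ {m} → (Fin m → ℕ) → ℕ → Fin (suc m)
cls {zero} φ ρ = zero
cls {suc m} φ ρ with cls (φ ∘ suc) ρ | φ zero ∣? ρ ∸ 1
... | suc j | _ = suc (suc j)
... | zero | yes _ = suc zero
... | zero | no _ = zero

cls-sound : ∀ {m} (φ : Fin m → ℕ) ρ →
  ≡1mod (φ̂ φ (cls φ ρ)) ρ × (∀ i → toℕ (cls φ ρ) < suc (toℕ i) → ¬ ≡1mod (φ i) ρ)
cls-sound {zero} φ ρ = 1∣ _ , λ ()
cls-sound {suc m} φ ρ with cls (φ ∘ suc) ρ | cls-sound (φ ∘ suc) ρ | φ zero ∣? ρ ∸ 1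
... | suc j | φⱼ∣ , above | _ = φⱼ∣ , λ { zero (s≤s ()) ; (suc i) (s≤s j<i) → above i j<i }
... | zero | _ , above | yes φ₀∣ = φ₀∣ , λ { zero (s≤s ()) ; (suc i) _ → above i (s≤s z≤n) }
... | zero | _ , above | no φ₀∤ = 1∣ _ , λ { zero _ → φ₀∤ ; (suc i) _ → above i (s≤s z≤n) }

prime⇒Cls-cls : ∀ {m} (φ : Fin m → ℕ) {ρ} → Prime ρ → Cls φ (cls φ ρ) ρ
prime⇒Cls-cls φ {ρ} ρ-prime = ρ-prime , cls-sound φ ρ

Cls? : ∀ {m} (φ : Fin m → ℕ) j → Decidable (Cls φ j)
Cls? φ j ρ = prime? ρ ×-dec (φ̂ φ j ∣? ρ ∸ 1) ×-dec all? (λ i → toℕ j <? suc (toℕ i) →-dec ¬? (φ i ∣? ρ ∸ 1))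

-- The first elements of a decidable set of naturals

module _ {S : ℕ → Set} (S? : Decidable S) where

  record LeastAbove (lo r : ℕ) : Set where
    field
      lo≤r   : lo ≤ r
      member : S r
      least  : ∀ {s} → lo ≤ s → S s → r ≤ s

  leastAbove : ∀ {lo y} → lo ≤‴ y → S y → ∃[ r ] r ≤ y × LeastAbove lo r
  leastAbove {lo} lo≤y Sy with S? lo
  ... | yes Slo = lo , ≤‴⇒≤ lo≤y , record { lo≤r = ≤-refl ; member = Slo ; least = λ lo≤s _ → lo≤s }
  ... | no ¬Slo with lo≤y
  ...   | ≤‴-refl = contradiction Sy ¬Slo
  ...   | ≤‴-step lo<y with leastAbove lo<y Sy
  ...     | r , r≤y , R = r , r≤y , record
    { lo≤r   = <⇒≤ (lo≤r R)
    ; member = member R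
    ; least  = λ lo≤s Ss → least R (≤∧≢⇒< lo≤s λ { refl → ¬Slo Ss }) Ss
    }
    where open LeastAbove

  linked-∷ : ∀ {r ns} → All (r <_) ns → Linked _<_ ns → Linked _<_ (r ∷ ns)
  linked-∷ [] _ = [-]
  linked-∷ (r<n ∷ _) sorted = r<n ∷ sorted

  -- Replace each element of a sorted list of elements of S by the least element of S
  -- above the previous replacement: no entry increases, and the result lists the first elements of S.
  firstElemsAbove : ∀ lo ns → AllPairs _<_ ns → All (λ n → lo ≤ n × S n) ns →
    ∃[ rs ] FirstElems (λ n → lo ≤ n × S n) (length ns) rs × product rs ≤ product ns
  firstElemsAbove lo [] [] [] = [] , record { len = refl ; sorted = [] ; members = [] ; initial = λ _ _ _ → [] } , ≤-refl
  firstElemsAbove lo (y ∷ ns) (y<ns ∷ ns-sorted) ((lo≤y , Sy) ∷ ns∈S) with leastAbove (≤⇒≤‴ lo≤y) Sy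
  ... | r , r≤y , R with firstElemsAbove (suc r) ns ns-sorted
                          (All.zipWith (λ (y<n , _ , Sn) → ≤-<-trans r≤y y<n , Sn) (y<ns , ns∈S))
  ...   | rs , F , rs≤ns = r ∷ rs , record
    { len     = cong suc (len F)
    ; sorted  = linked-∷ (All.map proj₁ (members F)) (sorted F)
    ; members = (lo≤r R , member R) ∷ All.map (λ (r<n , Sn) → ≤-trans (lo≤r R) (<⇒≤ r<n) , Sn) (members F)
    ; initial = initial′
    } , *-mono-≤ r≤y rs≤ns
    where
    open LeastAbove
    open FirstElems
    initial′ : ∀ p → lo ≤ p × S p → p ∉ r ∷ rs → All (_< p) (r ∷ rs)
    initial′ p (lo≤p , Sp) p∉ = r<p ∷ initial F p (r<p , Sp) (p∉ ∘ there)
      where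
      r<p : r < p
      r<p = ≤∧≢⇒< (least R lo≤p Sp) (p∉ ∘ here ∘ sym)

  firstElems : ∀ ns → AllPairs _<_ ns → All S ns → ∃[ rs ] FirstElems S (length ns) rs × product rs ≤ product ns
  firstElems ns ns-sorted ns∈S with firstElemsAbove 0 ns ns-sorted (All.map (z≤n ,_) ns∈S)
  ... | rs , F , rs≤ns = rs , record
    { len     = len F
    ; sorted  = sorted F
    ; members = All.map proj₂ (members F)
    ; initial = λ p Sp → initial F p (z≤n , Sp)
    } , rs≤ns
    where open FirstElems

module Factorisation {m} (φ a : Fin m → ℕ) (φ-prime : ∀ i → Prime (φ i)) where

  n : ℕ
  n = prodFin (λ i → φ i ^ a i)

  instance
    n≢0 : NonZero n
    n≢0 = >-nonZero (prodFin-positive λ i → m^n>0 (φ i) {{prime⇒nonZero (φ-prime i)}} (a i))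

  restT : Fin (suc m) → ℕ
  restT t = prodFin (λ i → if toℕ i <ᵇ toℕ t then 1 else φ i ^ a i)

  n≡invT*restT : ∀ t → n ≡ invT φ a t * restT t
  n≡invT*restT t = trans (prodFin-cong split) (prodFin-distrib-* {m} _ _)
    where
    split : ∀ i → φ i ^ a i ≡ (if toℕ i <ᵇ toℕ t then φ i ^ a i else 1) * (if toℕ i <ᵇ toℕ t then 1 else φ i ^ a i)
    split i with toℕ i <ᵇ toℕ t
    ... | true = sym (*-identityʳ _)
    ... | false = sym (*-identityˡ _)

  1≤invT : ∀ t → 1 ≤ invT φ a t
  1≤invT t = >-nonZero⁻¹ _ {{m*n≢0⇒m≢0 (invT φ a t) {{subst NonZero (n≡invT*restT t) n≢0}}}}

  Cls⇒coprime-restT : ∀ {j t ρ} → Cls φ j ρ → toℕ j ≤ toℕ t → Coprime (ρ ∸ 1) (restT t)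
  Cls⇒coprime-restT {j} {t} (_ , _ , above) j≤t = coprime-prodFin _ coprime-factor
    where
    coprime-factor : ∀ i → Coprime _ (if toℕ i <ᵇ toℕ t then 1 else φ i ^ a i)
    coprime-factor i with toℕ i <ᵇ toℕ t in i<ᵇt
    ... | true = coprime-1 _
    ... | false = coprime-^ (∤⇒coprime (φ-prime i) (above i (s≤s (≤-trans j≤t t≤i)))) (a i)
      where
      t≤i : toℕ t ≤ toℕ i
      t≤i = ≮⇒≥ (λ i<t → subst T i<ᵇt (<⇒<ᵇ i<t))

  gcd∣invT : ∀ {j t ρ} → Cls φ j ρ → toℕ j ≤ toℕ t → gcd n (ρ ∸ 1) ∣ invT φ a t
  gcd∣invT {j} {t} {ρ} ρ∈Πj j≤t = coprime-divisor coprime[gcd,restT] gcd∣restT*invT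
    where
    gcd∣restT*invT : gcd n (ρ ∸ 1) ∣ restT t * invT φ a t
    gcd∣restT*invT = subst (gcd n (ρ ∸ 1) ∣_) (trans (n≡invT*restT t) (*-comm (invT φ a t) (restT t))) (gcd[m,n]∣m n (ρ ∸ 1))
    coprime[gcd,restT] : Coprime (gcd n (ρ ∸ 1)) (restT t)
    coprime[gcd,restT] (i∣gcd , i∣restT) =
      Cls⇒coprime-restT ρ∈Πj j≤t (∣-trans i∣gcd (gcd[m,n]∣n n (ρ ∸ 1)) , i∣restT)

module PrimeDivisors {m} (φ a : Fin m → ℕ) (φ-prime : ∀ i → Prime (φ i)) (x : ℕ) (1<x : 1 < x) where

  open Factorisation φ a φ-prime

  instance
    x≢0 : NonZero x
    x≢0 = >-nonZero (<-trans z<s 1<x)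

  isPrimeDivisor? : Decidable (λ p → Prime p × p ∣ x ^ n ∸ 1)
  isPrimeDivisor? p = prime? p ×-dec (p ∣? x ^ n ∸ 1)

  primeDivisors : List ℕ
  primeDivisors = filter isPrimeDivisor? (upTo (suc (x ^ n ∸ 1)))

  ∈primeDivisors⇒ : ∀ {p} → p ∈ primeDivisors → Prime p × p ∣ x ^ n ∸ 1
  ∈primeDivisors⇒ = proj₂ ∘ ∈-filter⁻ isPrimeDivisor? {xs = upTo (suc (x ^ n ∸ 1))}

  primeDivisors-sorted : AllPairs _<_ primeDivisors
  primeDivisors-sorted = AllPairs.filter⁺ isPrimeDivisor? (AllPairs.applyUpTo⁺₁ id (suc (x ^ n ∸ 1)) λ i<j _ → i<j)

  ∣x^n∸1⇒∤x : ∀ {p} → Prime p → p ∣ x ^ n ∸ 1 → ¬ p ∣ x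
  ∣x^n∸1⇒∤x {p} p-prime p∣x^n∸1 p∣x = ¬prime[1] (subst Prime p≡1 p-prime)
    where
    p≡1 : p ≡ 1
    p≡1 = ∣x^m∸1⇒coprime x n p∣x^n∸1 (∣-refl , ∣-trans p∣x (x∣x^k x (>-nonZero⁻¹ n)))

  ∣x^n∸1⇒∣x^invT∸1 : ∀ {p j t} → Cls φ j p → toℕ j ≤ toℕ t → p ∣ x ^ n ∸ 1 → p ∣ x ^ invT φ a t ∸ 1
  ∣x^n∸1⇒∣x^invT∸1 {p} p∈Πj j≤t p∣x^n∸1 = ∣x^m∸1∧m∣n⇒∣x^n∸1 x (gcd∣invT p∈Πj j≤t)
    (∣x^m∸1∧∣x^n∸1⇒∣x^gcd[m,n]∸1 x n (p ∸ 1) p∣x^n∸1 (fermat p-prime (∣x^n∸1⇒∤x p-prime p∣x^n∸1)))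
    where
    p-prime : Prime p
    p-prime = proj₁ p∈Πj

  class : Fin (suc m) → List ℕ
  class j = fibre (cls φ) j primeDivisors

  class⊆Π : ∀ j → All (Cls φ j) (class j)
  class⊆Π j = All.tabulate λ {p} p∈class → let p∈primeDivisors , cls≡j = ∈-filter⁻ (λ q → cls φ q ≟ j) p∈class in
    subst (λ j → Cls φ j p) cls≡j (prime⇒Cls-cls φ (proj₁ (∈primeDivisors⇒ p∈primeDivisors)))

  firstOfClass : ∀ j → ∃[ rs ] FirstElems (Cls φ j) (length (class j)) rs × product rs ≤ product (class j)
  firstOfClass j = firstElems (Cls? φ j) (class j) (AllPairs.filter⁺ _ primeDivisors-sorted) (class⊆Π j)

  first : Fin (suc m) → List ℕ
  first j = proj₁ (firstOfClass j)

  first-FirstElems : ∀ j → FirstElems (Cls φ j) (length (class j)) (first j)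
  first-FirstElems j = proj₁ (proj₂ (firstOfClass j))

  product-first≤product-class : ∀ j → product (first j) ≤ product (class j)
  product-first≤product-class j = proj₂ (proj₂ (firstOfClass j))

  below : Fin (suc m) → Fin (suc m) → Bool
  below t j = toℕ j ≤ᵇ toℕ t

  classesBelow : Fin (suc m) → List ℕ
  classesBelow t = filter (T? ∘ below t ∘ cls φ) primeDivisors

  ∈classesBelow⇒ : ∀ {p t} → p ∈ classesBelow t → Prime p × p ∣ x ^ invT φ a t ∸ 1
  ∈classesBelow⇒ {p} {t} p∈ with ∈-filter⁻ (T? ∘ below t ∘ cls φ) p∈
  ... | p∈primeDivisors , cls≤t with ∈primeDivisors⇒ p∈primeDivisors
  ...   | p-prime , p∣x^n∸1 = p-prime , ∣x^n∸1⇒∣x^invT∸1 (prime⇒Cls-cls φ p-prime) (≤ᵇ⇒≤ _ _ cls≤t) p∣x^n∸1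

  product-classesBelow∣ : ∀ t → product (classesBelow t) ∣ x ^ invT φ a t ∸ 1
  product-classesBelow∣ t with All.unzip (All.tabulate (∈classesBelow⇒ {t = t}))
  ... | all-prime , all-∣ = product-∣ (sorted-primes-coprime all-prime (AllPairs.filter⁺ _ primeDivisors-sorted)) all-∣

  1<x^invT : ∀ t → 1 < x ^ invT φ a t
  1<x^invT t = <-≤-trans 1<x (subst (_≤ x ^ invT φ a t) (*-identityʳ x) (^-monoʳ-≤ x (1≤invT t)))

  bound : ∀ t → 1 + prodClasses first t ≤ x ^ invT φ a t
  bound t = begin
    1 + prodClasses first t
      ≤⟨ +-monoʳ-≤ 1 (prodFin-mono-≤ first≤class) ⟩
    1 + prodFin (λ j → if below t j then product (class j) else 1)
      ≡⟨ cong (1 +_) (prodFin-product-fibre (cls φ) (below t) primeDivisors) ⟩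
    1 + product (classesBelow t)
      ≤⟨ +-monoʳ-≤ 1 (∣⇒≤ {{x^invT∸1≢0}} (product-classesBelow∣ t)) ⟩
    1 + (x ^ invT φ a t ∸ 1)
      ≡⟨ m+[n∸m]≡n (m^n>0 x (invT φ a t)) ⟩
    x ^ invT φ a t ∎
    where
    open ≤-Reasoning
    first≤class : ∀ j → (if below t j then product (first j) else 1) ≤ (if below t j then product (class j) else 1)
    first≤class j with below t j
    ... | true = product-first≤product-class j
    ... | false = ≤-refl
    x^invT∸1≢0 : NonZero (x ^ invT φ a t ∸ 1)
    x^invT∸1≢0 = >-nonZero (m<n⇒0<n∸m (1<x^invT t))

theorem1p1 : (n m : ℕ) (φ a : Fin m → ℕ)
    → (∀ i → Prime (φ i))
    → (∀ i j → φ i ≡ φ j → i ≡ j)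
    → (∀ i → 1 ≤ a i)
    → n ≡ prodFin (λ i → φ i ^ a i)
    → (x : ℕ) → 1 < x
    → Σ (Fin (suc m) → ℕ) λ k →
        sumFin k ≡ ω (x ^ n ∸ 1)
        × Σ (Fin (suc m) → List ℕ) λ L →
            (∀ j → FirstElems (Cls φ j) (k j) (L j))
            × (∀ t → 1 + prodClasses L t ≤ x ^ invT φ a t)
theorem1p1 _ m φ a φ-prime _ _ refl x 1<x =
  length ∘ class , sumFin-length-fibre (cls φ) primeDivisors , first , first-FirstElems , bound
  where open PrimeDivisors φ a φ-prime x 1<x
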